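{- Let $G$ be a connected graph of order $n\ge 2$ with maximum degree $\Delta(G)\le \frac{2}{3}(n-1)$. Then $\xi^d(G)\ge 2\xi^c(G)$. Moreover, equality holds if and only if $G$ is $2$-self-centered and $\frac{2}{3}(n-1)$-regular.
   Context: All graphs are finite, simple and connected. For a vertex $v$: $\deg(v)$ is its degree, $\varepsilon(v)=\max_u d(v,u)$ its eccentricity, $D(v)=\sum_u d(v,u)$ its total distance ($d$ the shortest-path distance). $\xi^c(G)=\sum_v\varepsilon(v)\deg(v)$, $\xi^d(G)=\sum_v\varepsilon(v)D(v)$. $G$ is $2$-self-centered if every vertex has eccentricity $2$; $k$-regular if every vertex has degree $k$. -}

module Defs where

open import Data.Nat using (ℕ; zero; suc; _+_; _*_; _⊔_)
open import Data.Fin using (Fin; zero; suc)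
open import Data.Bool using (Bool; true; false; _∧_; _∨_; if_then_else_)
open import Data.Fin.Properties using () renaming (_≟_ to _≟F_)
open import Relation.Nullary.Decidable using (⌊_⌋)
open import Relation.Binary.PropositionalEquality using (_≡_)

sumF : ∀ {n} → (Fin n → ℕ) → ℕ
sumF {zero}  f = 0
sumF {suc n} f = f zero + sumF (λ i → f (suc i))

maxF : ∀ {n} → (Fin n → ℕ) → ℕ
maxF {zero}  f = 0
maxF {suc n} f = f zero ⊔ maxF (λ i → f (suc i))

anyF : ∀ {n} → (Fin n → Bool) → Bool
anyF {zero}  f = false
anyF {suc n} f = f zero ∨ anyF (λ i → f (suc i))

record Graph (n : ℕ) : Set where
  field
    adj    : Fin n → Fin n → Bool
    sym    : ∀ u v → adj u v ≡ adj v u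
    irrefl : ∀ v → adj v v ≡ false
open Graph public

data Walk {n} (G : Graph n) : Fin n → Fin n → Set where
  here : ∀ {v} → Walk G v v
  step : ∀ {u w v} → adj G u w ≡ true → Walk G w v → Walk G u v

Connected : ∀ {n} → Graph n → Set
Connected G = ∀ u v → Walk G u v

reach : ∀ {n} → Graph n → ℕ → Fin n → Fin n → Bool
reach G zero    u v = ⌊ u ≟F v ⌋
reach G (suc k) u v = reach G k u v ∨ anyF (λ w → reach G k u w ∧ adj G w v)

-- least k < bound with reach G k u v (returns bound if none)
distFrom : ∀ {n} → Graph n → ℕ → ℕ → Fin n → Fin n → ℕ
distFrom G k zero      u v = k
distFrom G k (suc fuel) u v =
  if reach G k u v then k else distFrom G (suc k) fuel u v

-- shortest-path distance d(u,v); in a connected graph on n vertices it is < n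
dist : ∀ {n} → Graph n → Fin n → Fin n → ℕ
dist {n} G u v = distFrom G 0 n u v

deg : ∀ {n} → Graph n → Fin n → ℕ
deg G v = sumF (λ w → if adj G v w then 1 else 0)

maxDeg : ∀ {n} → Graph n → ℕ
maxDeg G = maxF (deg G)

ecc : ∀ {n} → Graph n → Fin n → ℕ
ecc G v = maxF (dist G v)

totalDist : ∀ {n} → Graph n → Fin n → ℕ
totalDist G v = sumF (dist G v)

ξᶜ : ∀ {n} → Graph n → ℕ
ξᶜ G = sumF (λ v → ecc G v * deg G v)

ξᵈ : ∀ {n} → Graph n → ℕ
ξᵈ G = sumF (λ v → ecc G v * totalDist G v)

SelfCentered2 : ∀ {n} → Graph n → Set
SelfCentered2 G = ∀ v → ecc G v ≡ 2

module Submission where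

-- For a vertex v let nearDist v u be 0, 1 or 2 according as u = v, u is
-- a neighbour of v, or neither.  It is a lower bound for d(v,u), and equals it
-- as soon as d(v,u) ≤ 2.  Counting gives  Σᵤ nearDist v u + deg v = 2(n-1),
-- so whenever 3 deg v ≤ 2(n-1) we get  2 deg v ≤ Σᵤ nearDist v u ≤ D(v),
-- hence 2 ε(v) deg(v) ≤ ε(v) D(v); summing over v gives the inequality.
-- Equality of the sums forces D(v) = 2 deg v at every vertex (ε(v) ≥ 1 cancels),
-- which holds exactly when every distance from v is at most 2 and the degree
-- bound is tight; a vertex of eccentricity 1 would have degree n-1, which is
-- incompatible with 3 deg v = 2(n-1).  So ε(v) = 2 and 3 deg v = 2(n-1).

open import Defs
open import Data.Nat using (ℕ; _+_; _*_; _∸_; _≤_)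
open import Data.Product using (_×_; Σ)
open import Function.Bundles using (_⇔_)
open import Relation.Binary.PropositionalEquality using (_≡_)

open import Data.Nat using (zero; suc; z≤n; s≤s; _<_; >-nonZero)
open import Data.Nat.Properties
open import Algebra.Properties.CommutativeSemigroup *-commutativeSemigroup
  using (x∙yz≈y∙xz)
open import Algebra.Properties.CommutativeSemigroup +-commutativeSemigroup
  using (interchange)
open import Data.Fin using (Fin; zero; suc)
open import Data.Fin.Properties using () renaming (_≟_ to _≟F_)
open import Data.Bool using (Bool; true; false; _∧_; _∨_; if_then_else_)
open import Data.Bool.Properties using (∨-identityʳ)
open import Data.Product using (_,_; proj₁; proj₂)
open import Data.Empty using (⊥-elim)
open import Function.Bundles using (mk⇔; module Equivalence)
open Equivalence using (to; from)
open import Relation.Nullary using (¬_; yes; no)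
open import Relation.Nullary.Decidable using (⌊_⌋)
open import Relation.Binary.PropositionalEquality
  using (refl; trans; cong; cong₂; subst; module ≡-Reasoning)
  renaming (sym to ≡-sym)

sumF-cong : ∀ {n} {f g : Fin n → ℕ} → (∀ i → f i ≡ g i) → sumF f ≡ sumF g
sumF-cong {zero}  eq = refl
sumF-cong {suc n} eq = cong₂ _+_ (eq zero) (sumF-cong (λ i → eq (suc i)))

sumF-mono : ∀ {n} {f g : Fin n → ℕ} → (∀ i → f i ≤ g i) → sumF f ≤ sumF g
sumF-mono {zero}  le = z≤n
sumF-mono {suc n} le = +-mono-≤ (le zero) (sumF-mono (λ i → le (suc i)))

sumF-+ : ∀ {n} (f g : Fin n → ℕ) → sumF (λ i → f i + g i) ≡ sumF f + sumF g
sumF-+ {zero}  f g = refl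
sumF-+ {suc n} f g =
  trans (cong (f zero + g zero +_) (sumF-+ (λ i → f (suc i)) (λ i → g (suc i))))
        (interchange (f zero) (g zero) _ _)

sumF-*ˡ : ∀ {n} c (f : Fin n → ℕ) → sumF (λ i → c * f i) ≡ c * sumF f
sumF-*ˡ {zero}  c f = ≡-sym (*-zeroʳ c)
sumF-*ˡ {suc n} c f =
  trans (cong (c * f zero +_) (sumF-*ˡ c (λ i → f (suc i))))
        (≡-sym (*-distribˡ-+ c (f zero) _))

sumF-≡⇔pointwise : ∀ {n} {f g : Fin n → ℕ} → (∀ i → f i ≤ g i) →
  (sumF f ≡ sumF g) ⇔ (∀ i → f i ≡ g i)
sumF-≡⇔pointwise le = mk⇔ (pointwise le) sumF-cong
  where
  pointwise : ∀ {n} {f g : Fin n → ℕ} → (∀ i → f i ≤ g i) →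
    sumF f ≡ sumF g → ∀ i → f i ≡ g i
  pointwise {suc n} {f} {g} le eq = λ where
      zero    → head
      (suc i) → pointwise (λ j → le (suc j)) tail i
    where
    head : f zero ≡ g zero
    head = ≤-antisym (le zero)
      (+-cancelʳ-≤ _ _ _ (≤-trans (≤-reflexive (≡-sym eq))
        (+-monoʳ-≤ (f zero) (sumF-mono (λ j → le (suc j))))))
    tail : sumF (λ j → f (suc j)) ≡ sumF (λ j → g (suc j))
    tail = +-cancelˡ-≡ (f zero) _ _ (trans eq (cong (_+ _) (≡-sym head)))

sumF-punctured : ∀ {n} (g : Fin (suc n) → ℕ) v →
  g v ≡ 0 → (∀ u → ¬ v ≡ u → g u ≡ 1) → sumF g ≡ n
sumF-punctured g zero at-v elsewhere =
  cong₂ _+_ at-v (ones (λ i → elsewhere (suc i) (λ ())))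
  where
  ones : ∀ {n} {h : Fin n → ℕ} → (∀ i → h i ≡ 1) → sumF h ≡ n
  ones {zero}  _  = refl
  ones {suc n} eq = cong₂ _+_ (eq zero) (ones (λ i → eq (suc i)))
sumF-punctured {suc n} g (suc v) at-v elsewhere =
  cong₂ _+_ (elsewhere zero (λ ()))
    (sumF-punctured (λ i → g (suc i)) v at-v
      (λ u v≢u → elsewhere (suc u) (λ { refl → v≢u refl })))

maxF-ub : ∀ {n} (f : Fin n → ℕ) i → f i ≤ maxF f
maxF-ub f zero    = m≤m⊔n (f zero) _
maxF-ub f (suc i) = m≤n⇒m≤o⊔n (f zero) (maxF-ub (λ j → f (suc j)) i)

maxF-lub : ∀ {n} {f : Fin n → ℕ} {b} → (∀ i → f i ≤ b) → maxF f ≤ b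
maxF-lub {zero}  le = z≤n
maxF-lub {suc n} le = ⊔-lub (le zero) (maxF-lub (λ j → le (suc j)))

anyF-cong : ∀ {n} {f g : Fin n → Bool} → (∀ i → f i ≡ g i) → anyF f ≡ anyF g
anyF-cong {zero}  eq = refl
anyF-cong {suc n} eq = cong₂ _∨_ (eq zero) (anyF-cong (λ i → eq (suc i)))

anyF-false : ∀ n → anyF {n} (λ _ → false) ≡ false
anyF-false zero    = refl
anyF-false (suc n) = anyF-false n

≟F-suc : ∀ {n} (v w : Fin n) → ⌊ suc v ≟F suc w ⌋ ≡ ⌊ v ≟F w ⌋
≟F-suc v w with v ≟F w
... | yes _ = refl
... | no  _ = refl

anyF-select : ∀ {n} (f : Fin n → Bool) v → anyF (λ w → ⌊ v ≟F w ⌋ ∧ f w) ≡ f v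
anyF-select {suc n} f zero =
  trans (cong (f zero ∨_) (anyF-false n)) (∨-identityʳ (f zero))
anyF-select {suc n} f (suc v) =
  trans (anyF-cong (λ w → cong (_∧ f (suc w)) (≟F-suc v w)))
        (anyF-select (λ w → f (suc w)) v)

nearDist : ∀ {n} → Graph n → Fin n → Fin n → ℕ
nearDist G v u = if ⌊ v ≟F u ⌋ then 0 else (if adj G v u then 1 else 2)

adjInd : ∀ {n} → Graph n → Fin n → Fin n → ℕ
adjInd G v u = if adj G v u then 1 else 0

otherInd : ∀ {n} → Fin n → Fin n → ℕ
otherInd v u = if ⌊ v ≟F u ⌋ then 0 else 1

distFrom-≥ : ∀ {n} (G : Graph n) k fuel u v → k ≤ distFrom G k fuel u v
distFrom-≥ G k zero       u v = ≤-refl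
distFrom-≥ G k (suc fuel) u v with reach G k u v
... | true  = ≤-refl
... | false = ≤-trans (n≤1+n k) (distFrom-≥ G (suc k) fuel u v)

nearDist-pos : ∀ {n} (G : Graph n) {v u} → ¬ v ≡ u → 1 ≤ nearDist G v u
nearDist-pos G {v} {u} v≢u with v ≟F u
... | yes v≡u = ⊥-elim (v≢u v≡u)
... | no  _ with adj G v u
...   | true  = ≤-refl
...   | false = s≤s z≤n

nearDist≤2 : ∀ {n} (G : Graph n) v u → nearDist G v u ≤ 2
nearDist≤2 G v u with v ≟F u
... | yes _ = z≤n
... | no  _ with adj G v u
...   | true  = s≤s z≤n
...   | false = ≤-refl

-- Σᵤ nearDist v u: the total distance v would have if nothing were farther than 2.
nearTotal : ∀ {n} → Graph n → Fin n → ℕ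
nearTotal G v = sumF (nearDist G v)

nearDist+adjInd : ∀ {n} (G : Graph n) v u →
  nearDist G v u + adjInd G v u ≡ 2 * otherInd v u
nearDist+adjInd G v u with v ≟F u
... | yes refl rewrite irrefl G v = refl
... | no  _ with adj G v u
...   | true  = refl
...   | false = refl

sumF-otherInd : ∀ {k} (v : Fin (suc k)) → sumF (otherInd v) ≡ k
sumF-otherInd v = sumF-punctured (otherInd v) v at-v elsewhere
  where
  at-v : otherInd v v ≡ 0
  at-v with v ≟F v
  ... | yes _   = refl
  ... | no  v≢v = ⊥-elim (v≢v refl)
  elsewhere : ∀ u → ¬ v ≡ u → otherInd v u ≡ 1
  elsewhere u v≢u with v ≟F u
  ... | yes v≡u = ⊥-elim (v≢u v≡u)
  ... | no  _   = refl

nearTotal+deg : ∀ {k} (G : Graph (suc k)) v → nearTotal G v + deg G v ≡ 2 * k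
nearTotal+deg {k} G v = begin
  nearTotal G v + deg G v                    ≡⟨ ≡-sym (sumF-+ (nearDist G v) (adjInd G v)) ⟩
  sumF (λ u → nearDist G v u + adjInd G v u) ≡⟨ sumF-cong (nearDist+adjInd G v) ⟩
  sumF (λ u → 2 * otherInd v u)              ≡⟨ sumF-*ˡ 2 (otherInd v) ⟩
  2 * sumF (otherInd v)                      ≡⟨ cong (2 *_) (sumF-otherInd v) ⟩
  2 * k                                      ∎
  where open ≡-Reasoning

three-times : ∀ d → 3 * d ≡ 2 * d + d
three-times d = +-comm d (2 * d)

nearTotal≡2deg⇔regular : ∀ {k} (G : Graph (suc k)) v →
  (nearTotal G v ≡ 2 * deg G v) ⇔ (3 * deg G v ≡ 2 * k)
nearTotal≡2deg⇔regular G v = mk⇔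
  (λ eq → trans (three-times (deg G v))
            (trans (cong (_+ deg G v) (≡-sym eq)) (nearTotal+deg G v)))
  (λ reg → +-cancelʳ-≡ (deg G v) _ _
            (trans (nearTotal+deg G v) (trans (≡-sym reg) (three-times (deg G v)))))

twice-deg≤nearTotal : ∀ {k} (G : Graph (suc k)) v →
  3 * deg G v ≤ 2 * k → 2 * deg G v ≤ nearTotal G v
twice-deg≤nearTotal {k} G v bound = +-cancelʳ-≤ (deg G v) _ _ (begin
  2 * deg G v + deg G v   ≡⟨ ≡-sym (three-times (deg G v)) ⟩
  3 * deg G v             ≤⟨ bound ⟩
  2 * k                   ≡⟨ ≡-sym (nearTotal+deg G v) ⟩
  nearTotal G v + deg G v ∎)
  where open ≤-Reasoning

3*≢2* : ∀ {m} → 0 < m → ¬ 3 * m ≡ 2 * m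
3*≢2* {suc m} _ eq with +-cancelʳ-≡ (2 * suc m) (suc m) 0 eq
... | ()

another : ∀ {k} (v : Fin (suc (suc k))) → Σ (Fin (suc (suc k))) (λ u → ¬ v ≡ u)
another zero    = suc zero , λ ()
another (suc _) = zero , λ ()

module _ {k : ℕ} (G : Graph (suc (suc k))) where

  -- dist computes 0 and 1 correctly and is at least 2 otherwise, so it
  -- dominates nearDist ...
  nearDist≤dist : ∀ v u → nearDist G v u ≤ dist G v u
  nearDist≤dist v u with v ≟F u
  ... | yes _ = z≤n
  ... | no  _ rewrite anyF-select (λ w → adj G w u) v with adj G v u
  ...   | true  = ≤-refl
  ...   | false = distFrom-≥ G 2 k v u

  dist≤2⇒nearDist : ∀ v u → dist G v u ≤ 2 → dist G v u ≡ nearDist G v u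
  dist≤2⇒nearDist v u le with v ≟F u
  ... | yes _ = refl
  ... | no  _ rewrite anyF-select (λ w → adj G w u) v with adj G v u
  ...   | true  = refl
  ...   | false = ≤-antisym le (distFrom-≥ G 2 k v u)

  dist≤1⇒adjInd : ∀ v u → dist G v u ≤ 1 → adjInd G v u ≡ otherInd v u
  dist≤1⇒adjInd v u le with v ≟F u
  ... | yes refl rewrite irrefl G v = refl
  ... | no  _ rewrite anyF-select (λ w → adj G w u) v with adj G v u
  ...   | true  = refl
  ...   | false with ≤-trans (distFrom-≥ G 2 k v u) le
  ...     | s≤s ()

  -- With n ≥ 2 every vertex has another vertex, at distance ≥ 1.
  ecc-pos : ∀ v → 0 < ecc G v
  ecc-pos v with another v
  ... | u , v≢u = ≤-trans (nearDist-pos G v≢u)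
                    (≤-trans (nearDist≤dist v u) (maxF-ub (dist G v) u))

  nearTotal≤totalDist : ∀ v → nearTotal G v ≤ totalDist G v
  nearTotal≤totalDist v = sumF-mono (nearDist≤dist v)

  twice-deg≤totalDist : ∀ v → 3 * deg G v ≤ 2 * suc k → 2 * deg G v ≤ totalDist G v
  twice-deg≤totalDist v bound =
    ≤-trans (twice-deg≤nearTotal G v bound) (nearTotal≤totalDist v)

  ecc≤1⇒deg : ∀ v → ecc G v ≤ 1 → deg G v ≡ suc k
  ecc≤1⇒deg v le = trans
    (sumF-cong (λ u → dist≤1⇒adjInd v u (≤-trans (maxF-ub (dist G v) u) le)))
    (sumF-otherInd v)

  tight-vertex : ∀ v → 3 * deg G v ≤ 2 * suc k →
    (totalDist G v ≡ 2 * deg G v) ⇔ (ecc G v ≡ 2 × 3 * deg G v ≡ 2 * suc k)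
  tight-vertex v bound = mk⇔ tight⇒ ⇒tight
    where
    tight⇒ : totalDist G v ≡ 2 * deg G v → ecc G v ≡ 2 × 3 * deg G v ≡ 2 * suc k
    tight⇒ eq = ≤-antisym ecc≤2 ecc≥2 , regular
      where
      near≡total : nearTotal G v ≡ totalDist G v
      near≡total = ≤-antisym (nearTotal≤totalDist v)
        (subst (_≤ nearTotal G v) (≡-sym eq) (twice-deg≤nearTotal G v bound))
      regular : 3 * deg G v ≡ 2 * suc k
      regular = to (nearTotal≡2deg⇔regular G v) (trans near≡total eq)
      near≡dist : ∀ u → nearDist G v u ≡ dist G v u
      near≡dist = to (sumF-≡⇔pointwise (nearDist≤dist v)) near≡total
      ecc≤2 : ecc G v ≤ 2
      ecc≤2 = maxF-lub (λ u → subst (_≤ 2) (near≡dist u) (nearDist≤2 G v u))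
      ecc≥2 : 2 ≤ ecc G v
      ecc≥2 = ≰⇒> λ ecc≤1 →
        3*≢2* (s≤s z≤n) (subst (λ d → 3 * d ≡ 2 * suc k) (ecc≤1⇒deg v ecc≤1) regular)
    ⇒tight : ecc G v ≡ 2 × 3 * deg G v ≡ 2 * suc k → totalDist G v ≡ 2 * deg G v
    ⇒tight (ecc≡2 , regular) = trans
      (sumF-cong (λ u → dist≤2⇒nearDist v u (subst (dist G v u ≤_) ecc≡2 (maxF-ub (dist G v) u))))
      (from (nearTotal≡2deg⇔regular G v) regular)

twice-ξᶜ : ∀ {n} (G : Graph n) → 2 * ξᶜ G ≡ sumF (λ v → ecc G v * (2 * deg G v))
twice-ξᶜ G = trans (≡-sym (sumF-*ˡ 2 (λ v → ecc G v * deg G v)))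
                   (sumF-cong (λ v → x∙yz≈y∙xz 2 (ecc G v) (deg G v)))

theorem4p2 : (n : ℕ) → 2 ≤ n → (G : Graph n) → Connected G →
    3 * maxDeg G ≤ 2 * (n ∸ 1) →
    (2 * ξᶜ G ≤ ξᵈ G) ×
    ((ξᵈ G ≡ 2 * ξᶜ G) ⇔
      (SelfCentered2 G × (∀ v → 3 * deg G v ≡ 2 * (n ∸ 1))))
theorem4p2 (suc (suc k)) (s≤s (s≤s z≤n)) G _ Δ-bound = ξᵈ-bound , mk⇔ tight⇒ ⇒tight
  where
  bound : ∀ v → 3 * deg G v ≤ 2 * suc k
  bound v = ≤-trans (*-monoʳ-≤ 3 (maxF-ub (deg G) v)) Δ-bound
  pointwise : ∀ v → ecc G v * (2 * deg G v) ≤ ecc G v * totalDist G v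
  pointwise v = *-monoʳ-≤ (ecc G v) (twice-deg≤totalDist G v (bound v))
  ξᵈ-bound : 2 * ξᶜ G ≤ ξᵈ G
  ξᵈ-bound = subst (_≤ ξᵈ G) (≡-sym (twice-ξᶜ G)) (sumF-mono pointwise)
  tight-sum⇔ : (ξᵈ G ≡ 2 * ξᶜ G) ⇔
    (∀ v → ecc G v * (2 * deg G v) ≡ ecc G v * totalDist G v)
  tight-sum⇔ = mk⇔
    (λ eq → to (sumF-≡⇔pointwise pointwise) (≡-sym (trans eq (twice-ξᶜ G))))
    (λ eqs → ≡-sym (trans (twice-ξᶜ G) (sumF-cong eqs)))
  tight-vertex⇔ : ∀ v → (ecc G v * (2 * deg G v) ≡ ecc G v * totalDist G v) ⇔
    (ecc G v ≡ 2 × 3 * deg G v ≡ 2 * suc k)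
  tight-vertex⇔ v = mk⇔
    (λ eq → to (tight-vertex G v (bound v))
              (≡-sym (*-cancelˡ-≡ _ _ (ecc G v) {{>-nonZero (ecc-pos G v)}} eq)))
    (λ tight → cong (ecc G v *_) (≡-sym (from (tight-vertex G v (bound v)) tight)))
  tight⇒ : ξᵈ G ≡ 2 * ξᶜ G → SelfCentered2 G × (∀ v → 3 * deg G v ≡ 2 * suc k)
  tight⇒ eq = (λ v → proj₁ (to (tight-vertex⇔ v) (to tight-sum⇔ eq v)))
            , (λ v → proj₂ (to (tight-vertex⇔ v) (to tight-sum⇔ eq v)))
  ⇒tight : SelfCentered2 G × (∀ v → 3 * deg G v ≡ 2 * suc k) → ξᵈ G ≡ 2 * ξᶜ G
  ⇒tight (self-centred , regular) =
    from tight-sum⇔ (λ v → from (tight-vertex⇔ v) (self-centred v , regular v))
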